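{- Let $q$ be a prime power, $t\geq 2$, and let $T=\{(A_1,a_1),(A_2,a_2),(A_3,a_3)\}$ be a generic triple of vertices in $\mathrm{NG}(q,t)$. Put $c_1=\frac{a_1}{a_3}N\!\left(\frac{A_2-A_3}{A_1-A_2}\right)$, $c_2=\frac{a_2}{a_3}N\!\left(\frac{A_1-A_3}{A_1-A_2}\right)$ and $S(T)=\{X\in\mathbb{F}_{q^{t-1}}: N(X)=c_1 \text{ and } N(X+1)=c_2\}$. Then $\deg(T)=|S(T)|-1$ if $a_1=a_2=a_3$, and $\deg(T)=|S(T)|$ otherwise.
   Context: $N:\mathbb{F}_{q^{t-1}}\to\mathbb{F}_q$ is the norm $N(A)=A^{1+q+\cdots+q^{t-2}}$. The projective norm graph $\mathrm{NG}(q,t)$ has vertex set $\mathbb{F}_{q^{t-1}}\times\mathbb{F}_q^*$, with $(A,a)$ and $(B,b)$ adjacent iff $N(A+B)=ab$ (loops kept: $(A,a)$ is adjacent to itself iff $N(2A)=a^2$). For a vertex set $T$, $\deg(T)$ is the number of vertices adjacent to every element of $T$. A vertex set is generic if the first coordinates of its elements are pairwise distinct. -}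

module Defs where

open import Level using (Level; _⊔_) renaming (suc to lsuc)
open import Data.Nat using (ℕ; zero; suc; _∸_) renaming (_+_ to _+ℕ_; _^_ to _^ℕ_)
open import Data.Nat.Primality using (Prime)
open import Data.Bool using (Bool; _∧_; not)
open import Data.List using (List; length; filterᵇ; cartesianProduct)
open import Data.Product using (_×_; _,_; proj₁; proj₂; Σ; ∃)
open import Relation.Nullary using (¬_)
open import Relation.Binary.PropositionalEquality using (_≡_)
open import Relation.Nullary.Decidable using (⌊_⌋)
open import Relation.Binary using (Decidable)
open import Algebra.Bundles using (CommutativeRing)
open import Data.List.Relation.Unary.Enumerates.Setoid using (IsEnumeration)
open import Data.List.Relation.Unary.Unique.Setoid using (Unique)

IsPrimePower : ℕ → Set
IsPrimePower q = Σ ℕ λ p → Σ ℕ λ k → Prime p × (q ≡ p ^ℕ suc k)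


-- A finite field: a commutative ring with 1 ≉ 0, decidable equality,
-- multiplicative inverses of nonzero elements (x ⁻¹ is junk at 0),
-- and a duplicate-free complete enumeration of its elements.
record FiniteField (c ℓ : Level) : Set (lsuc (c ⊔ ℓ)) where
  field
    commRing : CommutativeRing c ℓ
  open CommutativeRing commRing public
  field
    _≟_       : Decidable _≈_
    1≉0       : ¬ (1# ≈ 0#)
    _⁻¹       : Carrier → Carrier
    inverseʳ  : ∀ x → ¬ (x ≈ 0#) → (x * (x ⁻¹)) ≈ 1#
    elements  : List Carrier
    complete  : IsEnumeration setoid elements
    unique    : Unique setoid elements

  size : ℕ
  size = length elements

  _/_ : Carrier → Carrier → Carrier
  x / y = x * (y ⁻¹)

  _^_ : Carrier → ℕ → Carrier
  x ^ zero  = 1#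
  x ^ suc n = x * (x ^ n)

  ≈? : Carrier → Carrier → Bool
  ≈? x y = ⌊ x ≟ y ⌋

  countᵇ : (Carrier → Bool) → ℕ
  countᵇ P = length (filterᵇ P elements)

geomSum : ℕ → ℕ → ℕ
geomSum q zero    = 0
geomSum q (suc m) = q ^ℕ m +ℕ geomSum q m

-- Throughout, L plays the role of 𝔽_{q^{t-1}} (|L| = q^(t-1)), and 𝔽_q is
-- identified with its unique subfield of order q, {x ∈ L | x ^ q ≈ x}.
module NormGraph {c ℓ} (L : FiniteField c ℓ) (q t : ℕ) where
  open FiniteField L

  N : Carrier → Carrier
  N A = A ^ geomSum q (t ∸ 1)

  inFq : Carrier → Bool
  inFq a = ≈? (a ^ q) a

  inFq* : Carrier → Bool
  inFq* a = inFq a ∧ not (≈? a 0#)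

  Vertex : Set c
  Vertex = Carrier × Carrier

  IsVertex : Vertex → Set ℓ
  IsVertex (A , a) = ((a ^ q) ≈ a) × ¬ (a ≈ 0#)

  -- adjacency (loops kept): N(A + B) = a b
  adjᵇ : Vertex → Vertex → Bool
  adjᵇ (A , a) (B , b) = ≈? (N (A + B)) (a * b)

  vertices : List Vertex
  vertices = filterᵇ (λ v → inFq* (proj₂ v)) (cartesianProduct elements elements)

  deg₃ : Vertex → Vertex → Vertex → ℕ
  deg₃ u v w = length (filterᵇ (λ x → adjᵇ u x ∧ (adjᵇ v x ∧ adjᵇ w x)) vertices)

  S-size : Vertex → Vertex → Vertex → ℕ
  S-size (A₁ , a₁) (A₂ , a₂) (A₃ , a₃) =
    countᵇ (λ X → ≈? (N X) c₁ ∧ ≈? (N (X + 1#)) c₂)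
    where
      c₁ = (a₁ / a₃) * N ((A₂ - A₃) / (A₁ - A₂))
      c₂ = (a₂ / a₃) * N ((A₁ - A₃) / (A₁ - A₂))

-- A common neighbour (X , x) of T is determined by W = A₃ + X: adjacency to (A₃ , a₃)
-- forces x = N(W) / a₃, and since N is multiplicative, adjacency to (A₁ , a₁) and (A₂ , a₂) says
-- exactly that Z = ζ (1 + α / W), where ζ = (A₂ - A₃) / (A₁ - A₂) and α = A₁ - A₃, satisfies
-- N(Z) = c₁ and N(Z + 1) = c₂. As Z is affine in 1 / W, this is a bijection onto S(T) minus the
-- point ζ (which would need 1 / W = 0), and x lies in 𝔽_q because N(W)^q = N(W) by Fermat's little
-- theorem in L. Finally ζ itself belongs to S(T) iff a₁ = a₂ = a₃.
module Submission where

open import Defs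
open import Data.Bool using (T; not; _∧_)
open import Data.Bool.Properties using (T-∧)
open import Data.Empty using (⊥-elim)
open import Data.List using (List; []; _∷_; _++_; length; map; foldr; filterᵇ; cartesianProduct)
open import Data.List.Properties using (length-map)
open import Data.List.Relation.Unary.All as All using (All; tabulateₛ)
open import Data.List.Relation.Unary.AllPairs as AllPairs using ([]; _∷_)
open import Data.List.Relation.Unary.Any as Any using (here; there)
import Data.List.Relation.Unary.All.Properties as AllP
import Data.List.Relation.Unary.Any.Properties as AnyP
import Data.List.Membership.Setoid as Membership
import Data.List.Membership.Setoid.Properties as MembershipP
import Data.List.Relation.Unary.Unique.Setoid as UniqueS
import Data.List.Relation.Unary.Unique.Setoid.Properties as UniqueP
import Data.List.Relation.Unary.Enumerates.Setoid.Properties as EnumerationP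
import Data.List.Relation.Binary.Permutation.Setoid as Permutation
import Data.List.Relation.Binary.Permutation.Setoid.Properties as PermutationP
import Data.List.Relation.Binary.Subset.Setoid as Subset
open import Data.Nat as ℕ using (ℕ; zero; suc; _≤_; _<_; _∸_; s≤s; z≤n; NonZero) renaming (_+_ to _+ℕ_; _^_ to _^ℕ_)
import Data.Nat.Properties as ℕₚ
open import Data.Nat.Primality using (prime⇒nonZero)
open import Data.Product using (_×_; _,_; proj₁; proj₂; Σ; map₂)
open import Data.Product.Function.NonDependent.Propositional using (_×-⇔_)
open import Data.Product.Relation.Binary.Pointwise.NonDependent using (_×ₛ_)
open import Function using (_∘_; _⇔_; mk⇔; Equivalence; case_of_)
open import Function.Construct.Composition using (_⇔-∘_)
open import Relation.Binary.Bundles using (Setoid)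
open import Relation.Binary.Definitions using (_Respects_)
open import Relation.Binary.PropositionalEquality as ≡ using (_≡_)
open import Relation.Nullary using (¬_; yes; no; T?)
open import Relation.Nullary.Decidable using (toWitness; fromWitness; toWitnessFalse; fromWitnessFalse)
open import Relation.Unary using (Pred)
import Algebra.Properties.Semiring.Exp as Exp
import Algebra.Properties.CommutativeSemiring.Exp as CommExp

module _ {a ℓ} (S : Setoid a ℓ) where
  open Setoid S
  open Membership S using (_∈_)
  open UniqueS S using (Unique)
  open Subset S using (_⊆_)
  open Permutation S using (_↭_; prep; ↭-refl; ↭-reflexive-≋; ↭-sym; ↭-trans)
  open PermutationP S using (shift; ∈-resp-↭; Unique-resp-↭)

  ∈-filterᵇ⇔ : ∀ {r p} {Q : Pred Carrier r} {x xs} → (∀ {y} → T (p y) ⇔ Q y) → Q Respects _≈_ →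
               x ∈ filterᵇ p xs ⇔ (x ∈ xs × Q x)
  ∈-filterᵇ⇔ {p = p} p⇔Q Q-resp = mk⇔
    (map₂ (to p⇔Q) ∘ MembershipP.∈-filter⁻ S (T? ∘ p) resp)
    (λ (x∈ , Qx) → MembershipP.∈-filter⁺ S (T? ∘ p) resp x∈ (from p⇔Q Qx))
    where
    open Equivalence
    resp : (T ∘ p) Respects _≈_
    resp x≈y = from p⇔Q ∘ Q-resp x≈y ∘ to p⇔Q

  ∉⇒≉ : ∀ {x y xs} → All (λ z → ¬ x ≈ z) xs → y ∈ xs → ¬ x ≈ y
  ∉⇒≉ x∉xs y∈xs = All.lookupₛ S (λ y≈z x≉y x≈z → x≉y (trans x≈z (sym y≈z))) x∉xs y∈xs

  unique-⊆-⊇⇒↭ : ∀ {xs ys} → Unique xs → Unique ys → xs ⊆ ys → ys ⊆ xs → xs ↭ ys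
  unique-⊆-⊇⇒↭ {[]} {[]} _ _ _ _ = ↭-refl
  unique-⊆-⊇⇒↭ {[]} {_ ∷ _} _ _ _ ys⊆[] with () ← ys⊆[] (here refl)
  unique-⊆-⊇⇒↭ {x ∷ xs} {ys} (x∉xs ∷ xs!) ys! xs⊆ys ys⊆xs
    with us , vs , w , x≈w , ys≋ ← MembershipP.∈-∃++ S (xs⊆ys (here refl)) =
    ↭-trans (prep x≈w (unique-⊆-⊇⇒↭ xs! rest! xs⊆rest rest⊆xs)) (↭-sym ys↭w∷rest)
    where
    rest : List Carrier
    rest = us ++ vs
    ys↭w∷rest : ys ↭ w ∷ rest
    ys↭w∷rest = ↭-trans (↭-reflexive-≋ ys≋) (shift refl us vs)
    w∷rest! : Unique (w ∷ rest)
    w∷rest! = Unique-resp-↭ ys↭w∷rest ys!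
    rest! : Unique rest
    rest! = AllPairs.tail w∷rest!
    xs⊆rest : xs ⊆ rest
    xs⊆rest b∈xs with ∈-resp-↭ ys↭w∷rest (xs⊆ys (there b∈xs))
    ... | here b≈w = ⊥-elim (∉⇒≉ x∉xs b∈xs (trans x≈w (sym b≈w)))
    ... | there b∈rest = b∈rest
    rest⊆xs : rest ⊆ xs
    rest⊆xs b∈rest with ys⊆xs (∈-resp-↭ (↭-sym ys↭w∷rest) (there b∈rest))
    ... | here b≈x = ⊥-elim (∉⇒≉ (AllPairs.head w∷rest!) b∈rest (trans (sym x≈w) (sym b≈x)))
    ... | there b∈xs = b∈xs

module _ {a b ℓ₁ ℓ₂} (S : Setoid a ℓ₁) (R : Setoid b ℓ₂) where
  open Setoid S using () renaming (_≈_ to _≈₁_)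
  open Setoid R using () renaming (_≈_ to _≈₂_)
  open Membership S using (_∈_)

  unique-map⁺ : ∀ {f xs} → (∀ {x y} → x ∈ xs → y ∈ xs → f x ≈₂ f y → x ≈₁ y) →
                UniqueS.Unique S xs → UniqueS.Unique R (map f xs)
  unique-map⁺ {xs = []} inj [] = []
  unique-map⁺ {xs = x ∷ xs} inj (x∉xs ∷ xs!) =
    AllP.map⁺ (tabulateₛ S λ y∈xs fx≈fy → ∉⇒≉ S x∉xs y∈xs (inj (here (Setoid.refl S)) (there y∈xs) fx≈fy))
    ∷ unique-map⁺ (λ x∈ y∈ → inj (there x∈) (there y∈)) xs!

geomSum-positive : ∀ q .{{_ : NonZero q}} m → 0 < geomSum q (suc m)
geomSum-positive q m = ℕₚ.≤-trans (ℕₚ.m^n>0 q m) (ℕₚ.m≤m+n _ _)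

geomSum-*-suc : ∀ q m → suc (geomSum q m ℕ.* q) ≡ q ^ℕ m +ℕ geomSum q m
geomSum-*-suc q zero    = ≡.refl
geomSum-*-suc q (suc m) = begin
  suc ((q ^ℕ m +ℕ geomSum q m) ℕ.* q)        ≡⟨ ≡.cong suc (ℕₚ.*-distribʳ-+ q (q ^ℕ m) (geomSum q m)) ⟩
  suc (q ^ℕ m ℕ.* q +ℕ geomSum q m ℕ.* q)    ≡⟨ ℕₚ.+-suc (q ^ℕ m ℕ.* q) _ ⟨
  q ^ℕ m ℕ.* q +ℕ suc (geomSum q m ℕ.* q)    ≡⟨ ≡.cong₂ _+ℕ_ (ℕₚ.*-comm (q ^ℕ m) q) (geomSum-*-suc q m) ⟩
  q ^ℕ suc m +ℕ (q ^ℕ m +ℕ geomSum q m)     ∎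
  where open ≡.≡-Reasoning

module FieldProperties {c ℓ} (F : FiniteField c ℓ) where
  open FiniteField F
  open import Algebra.Solver.Ring.NaturalCoefficients.Default commutativeSemiring using (solve; _:=_; _:*_)
  open import Algebra.Properties.Group +-group using (∙-cancelˡ; x∙y⁻¹≈ε⇒x≈y)
  open import Algebra.Properties.AbelianGroup +-abelianGroup using (xyx⁻¹≈y)
  open import Relation.Binary.Reasoning.Setoid setoid
  open Membership setoid using (_∈_)
  open Permutation setoid using (_↭_)
  open UniqueS setoid using (Unique)

  T-≈? : ∀ {x y} → T (≈? x y) ⇔ x ≈ y
  T-≈? = mk⇔ toWitness fromWitness

  T-not-≈? : ∀ {x y} → T (not (≈? x y)) ⇔ (¬ x ≈ y)
  T-not-≈? = mk⇔ toWitnessFalse fromWitnessFalse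

  x-y≉0 : ∀ {x y} → ¬ x ≈ y → ¬ x - y ≈ 0#
  x-y≉0 x≉y x-y≈0 = x≉y (x∙y⁻¹≈ε⇒x≈y _ _ x-y≈0)

  x+[y-x]≈y : ∀ x y → x + (y - x) ≈ y
  x+[y-x]≈y x y = trans (sym (+-assoc x y (- x))) (xyx⁻¹≈y x y)

  [x-y]+[y-z]≈x-z : ∀ x y z → (x - y) + (y - z) ≈ x - z
  [x-y]+[y-z]≈x-z x y z = begin
    (x - y) + (y - z)   ≈⟨ +-assoc x (- y) (y - z) ⟩
    x + (- y + (y - z)) ≈⟨ +-congˡ (+-assoc (- y) y (- z)) ⟨
    x + ((- y + y) - z) ≈⟨ +-congˡ (+-congʳ (-‿inverseˡ y)) ⟩
    x + (0# - z)        ≈⟨ +-congˡ (+-identityˡ (- z)) ⟩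
    x - z               ∎

  [x+y]+[z-x]≈z+y : ∀ x y z → (x + y) + (z - x) ≈ z + y
  [x+y]+[z-x]≈z+y x y z = begin
    (x + y) + (z - x) ≈⟨ +-congʳ (+-comm x y) ⟩
    (y + x) + (z - x) ≈⟨ +-assoc y x (z - x) ⟩
    y + (x + (z - x)) ≈⟨ +-congˡ (x+[y-x]≈y x z) ⟩
    y + z             ≈⟨ +-comm y z ⟩
    z + y             ∎

  +-cancelˡ : ∀ x {y z} → x + y ≈ x + z → y ≈ z
  +-cancelˡ x = ∙-cancelˡ x _ _

  ⁻¹-inverseˡ : ∀ {x} → ¬ x ≈ 0# → x ⁻¹ * x ≈ 1#
  ⁻¹-inverseˡ {x} x≉0 = trans (*-comm (x ⁻¹) x) (inverseʳ x x≉0)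

  *-cancelˡ : ∀ {x y z} → ¬ x ≈ 0# → x * y ≈ x * z → y ≈ z
  *-cancelˡ {x} {y} {z} x≉0 xy≈xz = begin
    y                ≈⟨ *-identityˡ y ⟨
    1# * y           ≈⟨ *-congʳ (⁻¹-inverseˡ x≉0) ⟨
    (x ⁻¹ * x) * y   ≈⟨ *-assoc _ _ _ ⟩
    x ⁻¹ * (x * y)   ≈⟨ *-congˡ xy≈xz ⟩
    x ⁻¹ * (x * z)   ≈⟨ *-assoc _ _ _ ⟨
    (x ⁻¹ * x) * z   ≈⟨ *-congʳ (⁻¹-inverseˡ x≉0) ⟩
    1# * z           ≈⟨ *-identityˡ z ⟩
    z                ∎

  *-nonzero : ∀ {x y} → ¬ x ≈ 0# → ¬ y ≈ 0# → ¬ x * y ≈ 0#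
  *-nonzero {x} x≉0 y≉0 xy≈0 = y≉0 (*-cancelˡ x≉0 (trans xy≈0 (sym (zeroʳ x))))

  ⁻¹-nonzero : ∀ {x} → ¬ x ≈ 0# → ¬ x ⁻¹ ≈ 0#
  ⁻¹-nonzero {x} x≉0 x⁻¹≈0 = 1≉0 (trans (sym (inverseʳ x x≉0)) (trans (*-congˡ x⁻¹≈0) (zeroʳ x)))

  -- Congruence of _⁻¹ is not an axiom; it only follows away from the junk value at 0#.
  ⁻¹-cong : ∀ {x y} → ¬ x ≈ 0# → x ≈ y → x ⁻¹ ≈ y ⁻¹
  ⁻¹-cong {x} {y} x≉0 x≈y = *-cancelˡ x≉0 (trans (inverseʳ x x≉0) (sym (trans (*-congʳ x≈y) (inverseʳ y y≉0))))
    where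
    y≉0 : ¬ y ≈ 0#
    y≉0 y≈0 = x≉0 (trans x≈y y≈0)

  ⁻¹-involutive : ∀ {x} → ¬ x ≈ 0# → x ⁻¹ ⁻¹ ≈ x
  ⁻¹-involutive {x} x≉0 =
    *-cancelˡ (⁻¹-nonzero x≉0) (trans (inverseʳ (x ⁻¹) (⁻¹-nonzero x≉0)) (sym (⁻¹-inverseˡ x≉0)))

  x*[y/x]≈y : ∀ {x} y → ¬ x ≈ 0# → x * (y / x) ≈ y
  x*[y/x]≈y {x} y x≉0 = begin
    x * (y * x ⁻¹)  ≈⟨ solve 3 (λ x y z → x :* (y :* z) := y :* (x :* z)) refl x y (x ⁻¹) ⟩
    y * (x * x ⁻¹)  ≈⟨ *-congˡ (inverseʳ x x≉0) ⟩
    y * 1#          ≈⟨ *-identityʳ y ⟩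
    y               ∎

  proportion⇔ : ∀ {p r s a b x} → ¬ b ≈ 0# → ¬ x ≈ 0# → ¬ r ≈ 0# →
                p * (b * x) ≈ r * s → (s ≈ a * x ⇔ p ≈ (a / b) * r)
  proportion⇔ {p} {r} {s} {a} {b} {x} b≉0 x≉0 r≉0 pbx≈rs = mk⇔ to from
    where
    b*[a/b]*r : b * ((a / b) * r) ≈ a * r
    b*[a/b]*r = trans (sym (*-assoc _ _ _)) (*-congʳ (x*[y/x]≈y a b≉0))
    to : s ≈ a * x → p ≈ (a / b) * r
    to s≈ax = *-cancelˡ b≉0 (trans (*-cancelˡ x≉0 (begin
      x * (b * p)  ≈⟨ solve 3 (λ x b p → x :* (b :* p) := p :* (b :* x)) refl x b p ⟩
      p * (b * x)  ≈⟨ pbx≈rs ⟩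
      r * s        ≈⟨ *-congˡ s≈ax ⟩
      r * (a * x)  ≈⟨ solve 3 (λ r a x → r :* (a :* x) := x :* (a :* r)) refl r a x ⟩
      x * (a * r)  ∎)) (sym b*[a/b]*r))
    from : p ≈ (a / b) * r → s ≈ a * x
    from p≈[a/b]r = *-cancelˡ r≉0 (begin
      r * s                  ≈⟨ pbx≈rs ⟨
      p * (b * x)            ≈⟨ *-congʳ p≈[a/b]r ⟩
      ((a / b) * r) * (b * x) ≈⟨ solve 4 (λ q r b x → (q :* r) :* (b :* x) := (b :* (q :* r)) :* x) refl (a / b) r b x ⟩
      (b * ((a / b) * r)) * x ≈⟨ *-congʳ b*[a/b]*r ⟩
      (a * r) * x            ≈⟨ *-assoc a r x ⟩
      a * (r * x)            ≈⟨ solve 3 (λ a r x → a :* (r :* x) := r :* (a :* x)) refl a r x ⟩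
      r * (a * x)            ∎)

  x≈[y/z]*x⇔y≈z : ∀ {x y z} → ¬ x ≈ 0# → ¬ z ≈ 0# → (x ≈ (y / z) * x ⇔ y ≈ z)
  x≈[y/z]*x⇔y≈z {x} {y} {z} x≉0 z≉0 = mk⇔
    (λ x≈[y/z]x → sym (trans (from proportion x≈[y/z]x) (*-identityʳ y)))
    (λ y≈z → to proportion (sym (trans (*-identityʳ y) y≈z)))
    where
    open Equivalence
    proportion : z ≈ y * 1# ⇔ x ≈ (y / z) * x
    proportion = proportion⇔ {x} {x} {z} {y} {z} {1#} z≉0 1≉0 x≉0 (*-congˡ (*-identityʳ z))

  -- The _^_ of Defs unfolds exactly like the library's semiring power, so its laws transfer.
  private
    module E = Exp semiring
    module CE = CommExp commutativeSemiring

  ^≡^ : ∀ x n → x ^ n ≡ x E.^ n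
  ^≡^ x zero    = ≡.refl
  ^≡^ x (suc n) = ≡.cong (x *_) (^≡^ x n)

  ^-congˡ : ∀ n {x y} → x ≈ y → x ^ n ≈ y ^ n
  ^-congˡ n {x} {y} rewrite ^≡^ x n | ^≡^ y n = E.^-congˡ n

  ^-homo-* : ∀ x m n → x ^ (m +ℕ n) ≈ x ^ m * x ^ n
  ^-homo-* x m n rewrite ^≡^ x (m +ℕ n) | ^≡^ x m | ^≡^ x n = E.^-homo-* x m n

  ^-assocʳ : ∀ x m n → (x ^ m) ^ n ≈ x ^ (m ℕ.* n)
  ^-assocʳ x m n rewrite ^≡^ (x ^ m) n | ^≡^ x m | ^≡^ x (m ℕ.* n) = E.^-assocʳ x m n

  ^-distrib-* : ∀ x y n → (x * y) ^ n ≈ x ^ n * y ^ n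
  ^-distrib-* x y n rewrite ^≡^ (x * y) n | ^≡^ x n | ^≡^ y n = CE.^-distrib-* x y n

  ^-nonzero : ∀ {x} n → ¬ x ≈ 0# → ¬ x ^ n ≈ 0#
  ^-nonzero zero    x≉0 = 1≉0
  ^-nonzero (suc n) x≉0 = *-nonzero x≉0 (^-nonzero n x≉0)

  0^n≈0 : ∀ {n} → 0 < n → 0# ^ n ≈ 0#
  0^n≈0 (s≤s _) = zeroˡ _

  nonzeros : List Carrier
  nonzeros = filterᵇ (λ y → not (≈? y 0#)) elements

  private
    nonzero-resp : (λ y → ¬ y ≈ 0#) Respects _≈_
    nonzero-resp y≈z y≉0 z≈0 = y≉0 (trans y≈z z≈0)

  ∈-nonzeros⁻ : ∀ {y} → y ∈ nonzeros → ¬ y ≈ 0#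
  ∈-nonzeros⁻ = proj₂ ∘ Equivalence.to (∈-filterᵇ⇔ setoid {xs = elements} T-not-≈? nonzero-resp)

  ∈-nonzeros⁺ : ∀ {y} → ¬ y ≈ 0# → y ∈ nonzeros
  ∈-nonzeros⁺ {y} y≉0 = Equivalence.from (∈-filterᵇ⇔ setoid {xs = elements} T-not-≈? nonzero-resp) (complete y , y≉0)

  nonzeros-unique : Unique nonzeros
  nonzeros-unique = UniqueP.filter⁺ setoid _ unique

  elements↭0∷nonzeros : elements ↭ 0# ∷ nonzeros
  elements↭0∷nonzeros = unique-⊆-⊇⇒↭ setoid unique (0∉nonzeros ∷ nonzeros-unique) ⊆ (λ {y} _ → complete y)
    where
    0∉nonzeros : All (λ z → ¬ 0# ≈ z) nonzeros
    0∉nonzeros = tabulateₛ setoid λ z∈ 0≈z → ∈-nonzeros⁻ z∈ (sym 0≈z)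
    ⊆ : ∀ {y} → y ∈ elements → y ∈ 0# ∷ nonzeros
    ⊆ {y} _ with y ≟ 0#
    ... | yes y≈0 = here y≈0
    ... | no y≉0  = there (∈-nonzeros⁺ y≉0)

  size≡1+|nonzeros| : size ≡ suc (length nonzeros)
  size≡1+|nonzeros| = PermutationP.xs↭ys⇒|xs|≡|ys| setoid elements↭0∷nonzeros

  product : List Carrier → Carrier
  product = foldr _*_ 1#

  product-map-* : ∀ y xs → product (map (y *_) xs) ≈ y ^ length xs * product xs
  product-map-* y []       = sym (*-identityˡ 1#)
  product-map-* y (x ∷ xs) = begin
    (y * x) * product (map (y *_) xs)     ≈⟨ *-congˡ (product-map-* y xs) ⟩
    (y * x) * (y ^ length xs * product xs)
      ≈⟨ solve 4 (λ y x p q → (y :* x) :* (p :* q) := (y :* p) :* (x :* q)) refl y x (y ^ length xs) (product xs) ⟩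
    (y * y ^ length xs) * (x * product xs) ∎

  product-nonzero : ∀ {xs} → (∀ {z} → z ∈ xs → ¬ z ≈ 0#) → ¬ product xs ≈ 0#
  product-nonzero {[]}     _      = 1≉0
  product-nonzero {x ∷ xs} nonzero = *-nonzero (nonzero (here refl)) (product-nonzero (nonzero ∘ there))

  map-*-nonzeros↭nonzeros : ∀ {y} → ¬ y ≈ 0# → map (y *_) nonzeros ↭ nonzeros
  map-*-nonzeros↭nonzeros {y} y≉0 =
    unique-⊆-⊇⇒↭ setoid (UniqueP.map⁺ setoid setoid (*-cancelˡ y≉0) nonzeros-unique) nonzeros-unique ⊆ ⊇
    where
    ⊆ : ∀ {z} → z ∈ map (y *_) nonzeros → z ∈ nonzeros
    ⊆ z∈ with b , b∈ , z≈yb ← MembershipP.∈-map⁻ setoid setoid z∈ =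
      ∈-nonzeros⁺ λ z≈0 → *-nonzero y≉0 (∈-nonzeros⁻ b∈) (trans (sym z≈yb) z≈0)
    ⊇ : ∀ {z} → z ∈ nonzeros → z ∈ map (y *_) nonzeros
    ⊇ {z} z∈ = MembershipP.∈-resp-≈ setoid (x*[y/x]≈y z y≉0)
      (MembershipP.∈-map⁺ setoid setoid *-congˡ (∈-nonzeros⁺ (*-nonzero (∈-nonzeros⁻ z∈) (⁻¹-nonzero y≉0))))

  -- Fermat: multiplying by x permutes the nonzero elements, so their product absorbs x ^ (size - 1).
  x^size≈x : ∀ {x} → ¬ x ≈ 0# → x ^ size ≈ x
  x^size≈x {x} x≉0 rewrite size≡1+|nonzeros| = trans (*-congˡ x^n≈1) (*-identityʳ x)
    where
    P : Carrier
    P = product nonzeros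
    x^n≈1 : x ^ length nonzeros ≈ 1#
    x^n≈1 = *-cancelˡ (product-nonzero ∈-nonzeros⁻) (begin
      P * x ^ length nonzeros        ≈⟨ *-comm _ _ ⟩
      x ^ length nonzeros * P        ≈⟨ product-map-* x nonzeros ⟨
      product (map (x *_) nonzeros)
        ≈⟨ PermutationP.foldr-commMonoid setoid *-isCommutativeMonoid (map-*-nonzeros↭nonzeros x≉0) ⟩
      P                              ≈⟨ *-identityʳ P ⟨
      P * 1#                         ∎)


module CommonNeighbours {c ℓ} (F : FiniteField c ℓ) (q t : ℕ) where
  open FiniteField F
  open NormGraph F q t
  open FieldProperties F

  N-cong : ∀ {x y} → x ≈ y → N x ≈ N y
  N-cong = ^-congˡ (geomSum q (t ∸ 1))

  vertexSetoid : Setoid c ℓ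
  vertexSetoid = setoid ×ₛ setoid
  open Setoid vertexSetoid using () renaming (_≈_ to _≈ᵥ_)
  open Membership vertexSetoid using (_∈_)

  Adjacent : Vertex → Vertex → Set ℓ
  Adjacent (A , a) (B , b) = N (A + B) ≈ a * b

  IsCommonNeighbour : Vertex → Vertex → Vertex → Vertex → Set ℓ
  IsCommonNeighbour u v w x = IsVertex x × Adjacent u x × Adjacent v x × Adjacent w x

  commonNeighbours : Vertex → Vertex → Vertex → List Vertex
  commonNeighbours u v w = filterᵇ (λ x → adjᵇ u x ∧ (adjᵇ v x ∧ adjᵇ w x)) vertices

  commonNeighbours-unique : ∀ u v w → UniqueS.Unique vertexSetoid (commonNeighbours u v w)
  commonNeighbours-unique u v w = UniqueP.filter⁺ vertexSetoid _ (UniqueP.filter⁺ vertexSetoid _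
    (UniqueP.cartesianProduct⁺ setoid setoid unique unique))

  private
    isVertex-resp : IsVertex Respects _≈ᵥ_
    isVertex-resp (_ , x≈y) (x^q≈x , x≉0) =
      trans (^-congˡ q (sym x≈y)) (trans x^q≈x x≈y) , λ y≈0 → x≉0 (trans x≈y y≈0)

    adjacent-resp : ∀ u → Adjacent u Respects _≈ᵥ_
    adjacent-resp _ (X≈Y , x≈y) adj = trans (N-cong (+-congˡ (sym X≈Y))) (trans adj (*-congˡ x≈y))

    adjacentToAll-resp : ∀ u v w → (λ x → Adjacent u x × Adjacent v x × Adjacent w x) Respects _≈ᵥ_
    adjacentToAll-resp u v w x≈y (adj-u , adj-v , adj-w) =
      adjacent-resp u x≈y adj-u , adjacent-resp v x≈y adj-v , adjacent-resp w x≈y adj-w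

  ∈-commonNeighbours⇔ : ∀ {u v w x} → x ∈ commonNeighbours u v w ⇔ IsCommonNeighbour u v w x
  ∈-commonNeighbours⇔ {u} {v} {w} {x} = mk⇔
    (λ x∈ → let x∈vertices , adj = to ∈-adj x∈ in proj₂ (to ∈-vertices x∈vertices) , adj)
    (λ (vertex , adj) → from ∈-adj (from ∈-vertices (x∈cart , vertex) , adj))
    where
    open Equivalence
    x∈cart : x ∈ cartesianProduct elements elements
    x∈cart = EnumerationP.cartesianProduct⁺ setoid setoid complete complete x
    ∈-vertices : x ∈ vertices ⇔ (x ∈ cartesianProduct elements elements × IsVertex x)
    ∈-vertices = ∈-filterᵇ⇔ vertexSetoid ((T-≈? ×-⇔ T-not-≈?) ⇔-∘ T-∧) isVertex-resp
    ∈-adj : x ∈ commonNeighbours u v w ⇔ (x ∈ vertices × Adjacent u x × Adjacent v x × Adjacent w x)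
    ∈-adj = ∈-filterᵇ⇔ vertexSetoid ((T-≈? ×-⇔ ((T-≈? ×-⇔ T-≈?) ⇔-∘ T-∧)) ⇔-∘ T-∧)
                       (adjacentToAll-resp u v w)

module Norm {c ℓ} (F : FiniteField c ℓ) (q k : ℕ) .{{_ : NonZero q}}
            (size≡q^[k+1] : FiniteField.size F ≡ q ^ℕ suc k) where
  open FiniteField F
  open NormGraph F q (suc (suc k))
  open FieldProperties F
  open CommonNeighbours F q (suc (suc k)) public
  open import Relation.Binary.Reasoning.Setoid setoid

  N-* : ∀ x y → N (x * y) ≈ N x * N y
  N-* x y = ^-distrib-* x y (geomSum q (suc k))

  N-nonzero : ∀ {x} → ¬ x ≈ 0# → ¬ N x ≈ 0#
  N-nonzero = ^-nonzero (geomSum q (suc k))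

  N-0 : N 0# ≈ 0#
  N-0 = 0^n≈0 (geomSum-positive q k)

  N^q≈N : ∀ {x} → ¬ x ≈ 0# → N x ^ q ≈ N x
  N^q≈N {x} x≉0 = *-cancelˡ x≉0 (begin
    x * (x ^ e) ^ q     ≈⟨ *-congˡ (^-assocʳ x e q) ⟩
    x ^ suc (e ℕ.* q)   ≡⟨ ≡.cong (x ^_) (geomSum-*-suc q (suc k)) ⟩
    x ^ (q ^ℕ suc k +ℕ e) ≈⟨ ^-homo-* x (q ^ℕ suc k) e ⟩
    x ^ (q ^ℕ suc k) * x ^ e ≈⟨ *-congʳ (≡.subst (λ n → x ^ n ≈ x) size≡q^[k+1] (x^size≈x x≉0)) ⟩
    x * x ^ e           ∎)
    where e = geomSum q (suc k)

  N-proportion : ∀ {W V Z z a b x} → ¬ b ≈ 0# → ¬ x ≈ 0# → ¬ z ≈ 0# →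
                 N W ≈ b * x → Z * W ≈ z * V → (N V ≈ a * x ⇔ N Z ≈ (a / b) * N z)
  N-proportion {W} {V} {Z} {z} {a} {b} {x} b≉0 x≉0 z≉0 NW≈bx ZW≈zV = proportion⇔ b≉0 x≉0 (N-nonzero z≉0) (begin
    N Z * (b * x) ≈⟨ *-congˡ NW≈bx ⟨
    N Z * N W     ≈⟨ N-* Z W ⟨
    N (Z * W)     ≈⟨ N-cong ZW≈zV ⟩
    N (z * V)     ≈⟨ N-* z V ⟩
    N z * N V     ∎)

  module Triple (A₁ a₁ A₂ a₂ A₃ a₃ : Carrier) (vertex₃ : IsVertex (A₃ , a₃))
                (A₁≉A₂ : ¬ A₁ ≈ A₂) (A₁≉A₃ : ¬ A₁ ≈ A₃) (A₂≉A₃ : ¬ A₂ ≈ A₃) where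
    open import Algebra.Solver.Ring.NaturalCoefficients.Default commutativeSemiring using (solve; _:=_; _:+_; _:*_)

    a₃^q≈a₃ : a₃ ^ q ≈ a₃
    a₃^q≈a₃ = proj₁ vertex₃
    a₃≉0 : ¬ a₃ ≈ 0#
    a₃≉0 = proj₂ vertex₃

    α β D ζ η κ c₁ c₂ : Carrier
    α = A₁ - A₃
    β = A₂ - A₃
    D = A₁ - A₂
    ζ = β / D
    η = α / D
    κ = ζ * α
    c₁ = (a₁ / a₃) * N ζ
    c₂ = (a₂ / a₃) * N η

    α≉0 : ¬ α ≈ 0#
    α≉0 = x-y≉0 A₁≉A₃
    β≉0 : ¬ β ≈ 0#
    β≉0 = x-y≉0 A₂≉A₃
    D⁻¹≉0 : ¬ D ⁻¹ ≈ 0#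
    D⁻¹≉0 = ⁻¹-nonzero (x-y≉0 A₁≉A₂)
    ζ≉0 : ¬ ζ ≈ 0#
    ζ≉0 = *-nonzero β≉0 D⁻¹≉0
    η≉0 : ¬ η ≈ 0#
    η≉0 = *-nonzero α≉0 D⁻¹≉0
    κ≉0 : ¬ κ ≈ 0#
    κ≉0 = *-nonzero ζ≉0 α≉0

    ζ+1≈η : ζ + 1# ≈ η
    ζ+1≈η = begin
      β * D ⁻¹ + 1#        ≈⟨ +-congˡ (inverseʳ D (x-y≉0 A₁≉A₂)) ⟨
      β * D ⁻¹ + D * D ⁻¹  ≈⟨ distribʳ (D ⁻¹) β D ⟨
      (β + D) * D ⁻¹       ≈⟨ *-congʳ (trans (+-comm β D) ([x-y]+[y-z]≈x-z A₁ A₂ A₃)) ⟩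
      α * D ⁻¹             ∎

    κ≈η*β : κ ≈ η * β
    κ≈η*β = solve 3 (λ β d α → (β :* d) :* α := (α :* d) :* β) refl β (D ⁻¹) α

    affine : Carrier → Carrier
    affine u = ζ + κ * u

    affine-injective : ∀ {u v} → affine u ≈ affine v → u ≈ v
    affine-injective = *-cancelˡ κ≉0 ∘ +-cancelˡ ζ

    affine-0 : affine 0# ≈ ζ
    affine-0 = trans (+-congˡ (zeroʳ κ)) (+-identityʳ ζ)

    affine-inv : Carrier → Carrier
    affine-inv Z = (Z - ζ) / κ

    affine-affine-inv : ∀ Z → affine (affine-inv Z) ≈ Z
    affine-affine-inv Z = trans (+-congˡ (x*[y/x]≈y (Z - ζ) κ≉0)) (x+[y-x]≈y ζ Z)

    affine-inv-nonzero : ∀ {Z} → ¬ Z ≈ ζ → ¬ affine-inv Z ≈ 0#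
    affine-inv-nonzero Z≉ζ = *-nonzero (x-y≉0 Z≉ζ) (⁻¹-nonzero κ≉0)

    affine*W≈ζ*[W+α] : ∀ {u W} → u * W ≈ 1# → affine u * W ≈ ζ * (W + α)
    affine*W≈ζ*[W+α] {u} {W} uW≈1 = begin
      (ζ + κ * u) * W     ≈⟨ solve 4 (λ ζ κ u W → (ζ :+ κ :* u) :* W := ζ :* W :+ κ :* (u :* W)) refl ζ κ u W ⟩
      ζ * W + κ * (u * W) ≈⟨ +-congˡ (trans (*-congˡ uW≈1) (*-identityʳ κ)) ⟩
      ζ * W + ζ * α       ≈⟨ distribˡ ζ W α ⟨
      ζ * (W + α)         ∎

    [affine+1]*W≈η*[W+β] : ∀ {u W} → u * W ≈ 1# → (affine u + 1#) * W ≈ η * (W + β)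
    [affine+1]*W≈η*[W+β] {u} {W} uW≈1 = begin
      (ζ + κ * u + 1#) * W
        ≈⟨ solve 5 (λ ζ κ u W o → (ζ :+ κ :* u :+ o) :* W := (ζ :+ o) :* W :+ κ :* (u :* W)) refl ζ κ u W 1# ⟩
      (ζ + 1#) * W + κ * (u * W) ≈⟨ +-cong (*-congʳ ζ+1≈η) (trans (*-congˡ uW≈1) (trans (*-identityʳ κ) κ≈η*β)) ⟩
      η * W + η * β             ≈⟨ distribˡ η W β ⟨
      η * (W + β)               ∎

    IsSolution : Carrier → Set ℓ
    IsSolution Z = N Z ≈ c₁ × N (Z + 1#) ≈ c₂

    φ : Carrier → Carrier
    φ X = affine ((A₃ + X) ⁻¹)

    φ-cong : ∀ {X Y} → ¬ A₃ + X ≈ 0# → X ≈ Y → φ X ≈ φ Y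
    φ-cong W≉0 X≈Y = +-congˡ (*-congˡ (⁻¹-cong W≉0 (+-congˡ X≈Y)))

    adjacent⇔IsSolution : ∀ {X x} → ¬ A₃ + X ≈ 0# → ¬ x ≈ 0# → N (A₃ + X) ≈ a₃ * x →
                          (N (A₁ + X) ≈ a₁ * x × N (A₂ + X) ≈ a₂ * x) ⇔ IsSolution (φ X)
    adjacent⇔IsSolution {X} W≉0 x≉0 NW≈a₃x =
      N-proportion a₃≉0 x≉0 ζ≉0 NW≈a₃x (trans (affine*W≈ζ*[W+α] W⁻¹W≈1) (*-congˡ ([x+y]+[z-x]≈z+y A₃ X A₁)))
      ×-⇔
      N-proportion a₃≉0 x≉0 η≉0 NW≈a₃x (trans ([affine+1]*W≈η*[W+β] W⁻¹W≈1) (*-congˡ ([x+y]+[z-x]≈z+y A₃ X A₂)))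
      where
      W⁻¹W≈1 : (A₃ + X) ⁻¹ * (A₃ + X) ≈ 1#
      W⁻¹W≈1 = ⁻¹-inverseˡ W≉0

    IsSolution-ζ⇔ : IsSolution ζ ⇔ (a₁ ≈ a₂ × a₂ ≈ a₃)
    IsSolution-ζ⇔ = mk⇔
      (λ (Nζ≈c₁ , N[ζ+1]≈c₂) → let a₂≈a₃ = to Nη-fixed⇔ (trans (N-cong (sym ζ+1≈η)) N[ζ+1]≈c₂) in
         trans (to Nζ-fixed⇔ Nζ≈c₁) (sym a₂≈a₃) , a₂≈a₃)
      (λ (a₁≈a₂ , a₂≈a₃) →
         from Nζ-fixed⇔ (trans a₁≈a₂ a₂≈a₃) , trans (N-cong ζ+1≈η) (from Nη-fixed⇔ a₂≈a₃))
      where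
      open Equivalence
      Nζ-fixed⇔ : N ζ ≈ (a₁ / a₃) * N ζ ⇔ a₁ ≈ a₃
      Nζ-fixed⇔ = x≈[y/z]*x⇔y≈z {y = a₁} (N-nonzero ζ≉0) a₃≉0
      Nη-fixed⇔ : N η ≈ (a₂ / a₃) * N η ⇔ a₂ ≈ a₃
      Nη-fixed⇔ = x≈[y/z]*x⇔y≈z {y = a₂} (N-nonzero η≉0) a₃≉0

    IsSolution-resp : IsSolution Respects _≈_
    IsSolution-resp Y≈Z (NY≈c₁ , N[Y+1]≈c₂) =
      trans (N-cong (sym Y≈Z)) NY≈c₁ , trans (N-cong (+-congʳ (sym Y≈Z))) N[Y+1]≈c₂

    IsNeighbour : Vertex → Set ℓ
    IsNeighbour = IsCommonNeighbour (A₁ , a₁) (A₂ , a₂) (A₃ , a₃)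

    neighbour-W≉0 : ∀ {X x} → IsNeighbour (X , x) → ¬ A₃ + X ≈ 0#
    neighbour-W≉0 ((_ , x≉0) , _ , _ , NW≈a₃x) W≈0 =
      *-nonzero a₃≉0 x≉0 (trans (sym NW≈a₃x) (trans (N-cong W≈0) N-0))

    neighbour⇒IsSolution : ∀ {X x} → IsNeighbour (X , x) → IsSolution (φ X)
    neighbour⇒IsSolution n@((_ , x≉0) , adj₁ , adj₂ , adj₃) =
      Equivalence.to (adjacent⇔IsSolution (neighbour-W≉0 n) x≉0 adj₃) (adj₁ , adj₂)

    φ≉ζ : ∀ {X} → ¬ A₃ + X ≈ 0# → ¬ φ X ≈ ζ
    φ≉ζ W≉0 φX≈ζ = ⁻¹-nonzero W≉0 (affine-injective (trans φX≈ζ (sym affine-0)))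

    φ-injective : ∀ {X x Y y} → IsNeighbour (X , x) → IsNeighbour (Y , y) → φ X ≈ φ Y → X ≈ Y × x ≈ y
    φ-injective {X} {x} {Y} {y} nX@(_ , _ , _ , adjX) nY@(_ , _ , _ , adjY) φX≈φY = X≈Y , x≈y
      where
      W≉0 : ¬ A₃ + X ≈ 0#
      W≉0 = neighbour-W≉0 nX
      W′≉0 : ¬ A₃ + Y ≈ 0#
      W′≉0 = neighbour-W≉0 nY
      W≈W′ : A₃ + X ≈ A₃ + Y
      W≈W′ = begin
        A₃ + X          ≈⟨ ⁻¹-involutive W≉0 ⟨
        (A₃ + X) ⁻¹ ⁻¹  ≈⟨ ⁻¹-cong (⁻¹-nonzero W≉0) (affine-injective φX≈φY) ⟩
        (A₃ + Y) ⁻¹ ⁻¹  ≈⟨ ⁻¹-involutive W′≉0 ⟩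
        A₃ + Y          ∎
      X≈Y : X ≈ Y
      X≈Y = +-cancelˡ A₃ W≈W′
      x≈y : x ≈ y
      x≈y = *-cancelˡ a₃≉0 (trans (sym adjX) (trans (N-cong W≈W′) adjY))

    IsSolution⇒neighbour : ∀ {Z} → IsSolution Z → ¬ Z ≈ ζ → Σ Vertex λ v → IsNeighbour v × φ (proj₁ v) ≈ Z
    IsSolution⇒neighbour {Z} isSolution Z≉ζ =
      (X , x) , ((x^q≈x , x≉0) , proj₁ adjacent , proj₂ adjacent , NW′≈a₃x) , φX≈Z
      where
      u W X x : Carrier
      u = affine-inv Z
      W = u ⁻¹
      X = W - A₃
      x = N W / a₃
      u≉0 : ¬ u ≈ 0#
      u≉0 = affine-inv-nonzero Z≉ζ
      W≉0 : ¬ W ≈ 0#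
      W≉0 = ⁻¹-nonzero u≉0
      W′≈W : A₃ + X ≈ W
      W′≈W = x+[y-x]≈y A₃ W
      W′≉0 : ¬ A₃ + X ≈ 0#
      W′≉0 W′≈0 = W≉0 (trans (sym W′≈W) W′≈0)
      NW≈a₃x : N W ≈ a₃ * x
      NW≈a₃x = sym (x*[y/x]≈y (N W) a₃≉0)
      NW′≈a₃x : N (A₃ + X) ≈ a₃ * x
      NW′≈a₃x = trans (N-cong W′≈W) NW≈a₃x
      x≉0 : ¬ x ≈ 0#
      x≉0 = *-nonzero (N-nonzero W≉0) (⁻¹-nonzero a₃≉0)
      x^q≈x : x ^ q ≈ x
      x^q≈x = *-cancelˡ a₃≉0 (begin
        a₃ * x ^ q      ≈⟨ *-congʳ a₃^q≈a₃ ⟨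
        a₃ ^ q * x ^ q  ≈⟨ ^-distrib-* a₃ x q ⟨
        (a₃ * x) ^ q    ≈⟨ ^-congˡ q NW≈a₃x ⟨
        N W ^ q         ≈⟨ N^q≈N W≉0 ⟩
        N W             ≈⟨ NW≈a₃x ⟩
        a₃ * x          ∎)
      φX≈Z : φ X ≈ Z
      φX≈Z = trans (+-congˡ (*-congˡ (trans (⁻¹-cong W′≉0 W′≈W) (⁻¹-involutive u≉0)))) (affine-affine-inv Z)
      adjacent : N (A₁ + X) ≈ a₁ * x × N (A₂ + X) ≈ a₂ * x
      adjacent = Equivalence.from (adjacent⇔IsSolution W′≉0 x≉0 NW′≈a₃x) (IsSolution-resp (sym φX≈Z) isSolution)

    open Membership setoid using () renaming (_∈_ to _∈ₑ_)
    open Subset setoid using (_⊆_)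
    open Permutation setoid using (_↭_)

    neighbours : List Vertex
    neighbours = commonNeighbours (A₁ , a₁) (A₂ , a₂) (A₃ , a₃)

    image : List Carrier
    image = map (φ ∘ proj₁) neighbours

    solutions : List Carrier
    solutions = filterᵇ (λ X → ≈? (N X) c₁ ∧ ≈? (N (X + 1#)) c₂) elements

    ∈-solutions⇔ : ∀ {Z} → Z ∈ₑ solutions ⇔ IsSolution Z
    ∈-solutions⇔ {Z} = mk⇔ (proj₂ ∘ to ∈-filter) (λ isSolution → from ∈-filter (complete Z , isSolution))
      where
      open Equivalence
      ∈-filter : Z ∈ₑ solutions ⇔ (Z ∈ₑ elements × IsSolution Z)
      ∈-filter = ∈-filterᵇ⇔ setoid ((T-≈? ×-⇔ T-≈?) ⇔-∘ T-∧) IsSolution-resp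

    image-unique : UniqueS.Unique setoid image
    image-unique = unique-map⁺ vertexSetoid setoid
      (λ v∈ w∈ → φ-injective (Equivalence.to ∈-commonNeighbours⇔ v∈) (Equivalence.to ∈-commonNeighbours⇔ w∈))
      (commonNeighbours-unique _ _ _)

    image⊆solutions : image ⊆ solutions
    image⊆solutions Z∈ with v , v∈ , Z≈φv ← MembershipP.∈-map⁻ vertexSetoid setoid Z∈ =
      Equivalence.from ∈-solutions⇔
        (IsSolution-resp (sym Z≈φv) (neighbour⇒IsSolution (Equivalence.to ∈-commonNeighbours⇔ v∈)))

    ζ∉image : All (λ Z → ¬ ζ ≈ Z) image
    ζ∉image = tabulateₛ setoid λ Z∈ ζ≈Z → case MembershipP.∈-map⁻ vertexSetoid setoid Z∈ of λ (v , v∈ , Z≈φv) →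
      φ≉ζ (neighbour-W≉0 (Equivalence.to ∈-commonNeighbours⇔ v∈)) (sym (trans ζ≈Z Z≈φv))

    solution≉ζ⇒∈image : ∀ {Z} → Z ∈ₑ solutions → ¬ Z ≈ ζ → Z ∈ₑ image
    solution≉ζ⇒∈image {Z} Z∈ Z≉ζ = AnyP.map⁺ (Any.map φ-at (Equivalence.from ∈-commonNeighbours⇔ neighbour))
      where
      preimage : Σ Vertex λ v → IsNeighbour v × φ (proj₁ v) ≈ Z
      preimage = IsSolution⇒neighbour (Equivalence.to ∈-solutions⇔ Z∈) Z≉ζ
      v : Vertex
      v = proj₁ preimage
      neighbour : IsNeighbour v
      neighbour = proj₁ (proj₂ preimage)
      φ-at : ∀ {w} → Setoid._≈_ vertexSetoid v w → Z ≈ φ (proj₁ w)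
      φ-at v≈w = trans (sym (proj₂ (proj₂ preimage))) (φ-cong (neighbour-W≉0 neighbour) (proj₁ v≈w))

    solutions-unique : UniqueS.Unique setoid solutions
    solutions-unique = UniqueP.filter⁺ setoid _ unique

    deg₃≡|image| : deg₃ (A₁ , a₁) (A₂ , a₂) (A₃ , a₃) ≡ length image
    deg₃≡|image| = ≡.sym (length-map (φ ∘ proj₁) neighbours)

    image↭solutions : ¬ (a₁ ≈ a₂ × a₂ ≈ a₃) → image ↭ solutions
    image↭solutions a≉ = unique-⊆-⊇⇒↭ setoid image-unique solutions-unique image⊆solutions
      λ Z∈ → solution≉ζ⇒∈image Z∈ λ Z≈ζ →
        a≉ (Equivalence.to IsSolution-ζ⇔ (IsSolution-resp Z≈ζ (Equivalence.to ∈-solutions⇔ Z∈)))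

    ζ∷image↭solutions : a₁ ≈ a₂ × a₂ ≈ a₃ → ζ ∷ image ↭ solutions
    ζ∷image↭solutions a≈ =
      unique-⊆-⊇⇒↭ setoid (ζ∉image ∷ image-unique) solutions-unique ζ∷image⊆solutions solutions⊆ζ∷image
      where
      ζ∷image⊆solutions : (ζ ∷ image) ⊆ solutions
      ζ∷image⊆solutions (here Z≈ζ) =
        Equivalence.from ∈-solutions⇔ (IsSolution-resp (sym Z≈ζ) (Equivalence.from IsSolution-ζ⇔ a≈))
      ζ∷image⊆solutions (there Z∈) = image⊆solutions Z∈
      solutions⊆ζ∷image : solutions ⊆ (ζ ∷ image)
      solutions⊆ζ∷image {Z} Z∈ with Z ≟ ζ
      ... | yes Z≈ζ = here Z≈ζ
      ... | no Z≉ζ  = there (solution≉ζ⇒∈image Z∈ Z≉ζ)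

    deg₃≡S-size : ¬ (a₁ ≈ a₂ × a₂ ≈ a₃) →
                  deg₃ (A₁ , a₁) (A₂ , a₂) (A₃ , a₃) ≡ S-size (A₁ , a₁) (A₂ , a₂) (A₃ , a₃)
    deg₃≡S-size a≉ = ≡.trans deg₃≡|image| (PermutationP.xs↭ys⇒|xs|≡|ys| setoid (image↭solutions a≉))

    deg₃+1≡S-size : a₁ ≈ a₂ × a₂ ≈ a₃ →
                    deg₃ (A₁ , a₁) (A₂ , a₂) (A₃ , a₃) +ℕ 1 ≡ S-size (A₁ , a₁) (A₂ , a₂) (A₃ , a₃)
    deg₃+1≡S-size a≈ = ≡.trans (ℕₚ.+-comm _ 1)
      (≡.trans (≡.cong suc deg₃≡|image|) (PermutationP.xs↭ys⇒|xs|≡|ys| setoid (ζ∷image↭solutions a≈)))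

primePower⇒nonZero : ∀ {q} → IsPrimePower q → NonZero q
primePower⇒nonZero (p , k , p-prime , ≡.refl) = ℕₚ.m^n≢0 p (suc k) {{prime⇒nonZero p-prime}}

mainTheorem8 : ∀ {c ℓ} (q t : ℕ) → IsPrimePower q → 2 ≤ t →
    (L : FiniteField c ℓ) → FiniteField.size L ≡ q ^ℕ (t ∸ 1) →
    let open FiniteField L
        open NormGraph L q t
    in (A₁ a₁ A₂ a₂ A₃ a₃ : Carrier) →
       IsVertex (A₁ , a₁) → IsVertex (A₂ , a₂) → IsVertex (A₃ , a₃) →
       ¬ (A₁ ≈ A₂) → ¬ (A₁ ≈ A₃) → ¬ (A₂ ≈ A₃) →
       ((a₁ ≈ a₂) × (a₂ ≈ a₃) →
          deg₃ (A₁ , a₁) (A₂ , a₂) (A₃ , a₃) +ℕ 1 ≡ S-size (A₁ , a₁) (A₂ , a₂) (A₃ , a₃))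
       × (¬ ((a₁ ≈ a₂) × (a₂ ≈ a₃)) →
          deg₃ (A₁ , a₁) (A₂ , a₂) (A₃ , a₃) ≡ S-size (A₁ , a₁) (A₂ , a₂) (A₃ , a₃))
mainTheorem8 q (suc (suc k)) q-primePower (s≤s (s≤s z≤n)) L size≡q^[k+1]
             A₁ a₁ A₂ a₂ A₃ a₃ _ _ vertex₃ A₁≉A₂ A₁≉A₃ A₂≉A₃ =
  deg₃+1≡S-size , deg₃≡S-size
  where
  open Norm L q k {{primePower⇒nonZero q-primePower}} size≡q^[k+1]
  open Triple A₁ a₁ A₂ a₂ A₃ a₃ vertex₃ A₁≉A₂ A₁≉A₃ A₂≉A₃
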